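{- In Algorithm I (see context), while processing constraint $h$, the total increase of the primal objective $\sum_{i=1}^n c_ix_i$ is at most $2\,t_h\,d_{m(h)}$.
   Context: Online covering LP without upper bounds: $n$ variables with costs $c_i>0$; constraints $\sum_{i=1}^n a_{ij}x_i\ge 1$ ($a_{ij}\ge 0$) arrive one at a time, $j=1,2,\dots$; $T_j=\{i:a_{ij}>0\}$, assumed nonempty. $\log=\log_2$. Algorithm I (primal part): start with $x=0$. When constraint $h$ arrives, set $k$ to the smallest power of $2$ that is at least $\max\{2,|T_1|,\dots,|T_h|\}$. Let $d_{ih}=c_i/a_{ih}$ for $i\in T_h$ and $d_{m(h)}=\min_{i\in T_h}d_{ih}$. While $\sum_i a_{ih}x_i<1$, replace simultaneously for all $i\in T_h$: $x_i\leftarrow (1+d_{m(h)}/d_{ih})x_i+\frac{1}{k a_{ih}}\cdot\frac{d_{m(h)}}{d_{ih}}$. Let $t_h$ be the number of times this update is performed for constraint $h$.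
   Formalization: The costs $c_i$ and the coefficients $a_{ij}$ are rational numbers, as are the entries of the primal vector $x$. -}

module Defs where

open import Data.Nat as ℕ using (ℕ; zero; suc; _⊔_; _^_)
open import Data.Nat.Logarithm using (⌈log₂_⌉)
open import Data.Integer using (+_)
open import Data.Rational using (ℚ; 0ℚ; 1ℚ; _+_; _*_; _-_; _<_; _≤_; _⊓_; 1/_; _/_; ≢-nonZero)
open import Data.Rational.Properties using (_≟_; _<?_)
open import Data.Fin using (Fin)
open import Data.List using (List; []; _∷_; _++_; [_]; map; filter; length; allFin; foldr)
open import Data.Product using (Σ; _×_)
open import Relation.Nullary using (yes; no)

Vecℚ : ℕ → Set
Vecℚ n = Fin n → ℚ

sumℚ : List ℚ → ℚ
sumℚ = foldr _+_ 0ℚ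

Σ[_] : ∀ {n} → Vecℚ n → ℚ
Σ[_] {n} f = sumℚ (map f (allFin n))

-- Reciprocal 1/q, used only for q ≠ 0 (the value at 0 is irrelevant).
inv : ℚ → ℚ
inv q with q ≟ 0ℚ
... | yes _  = 0ℚ
... | no q≢0 = 1/_ q {{≢-nonZero q≢0}}

-- A covering constraint  Σ_i a_i x_i ≥ 1  with a_i ≥ 0 and nonempty support.
record Constraint (n : ℕ) : Set where
  field
    coef    : Vecℚ n
    nonneg  : ∀ i → 0ℚ ≤ coef i
    nonempt : Σ (Fin n) (λ i → 0ℚ < coef i)
open Constraint public

support : ∀ {n} → Constraint n → List (Fin n)
support {n} a = filter (λ i → 0ℚ <? coef a i) (allFin n)

size : ∀ {n} → Constraint n → ℕ
size a = length (support a)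

pow2ceil : ℕ → ℕ
pow2ceil m = 2 ^ ⌈log₂ m ⌉

-- k for the current constraint h, given the list of constraints 1..h:
-- smallest power of 2 ≥ max{2, |T_1|, …, |T_h|}.
kOf : ∀ {n} → List (Constraint n) → ℕ
kOf cs = pow2ceil (foldr _⊔_ 2 (map size cs))

minList : List ℚ → ℚ
minList []           = 0ℚ
minList (x ∷ [])     = x
minList (x ∷ y ∷ ys) = x ⊓ minList (y ∷ ys)

d : ∀ {n} → Vecℚ n → Constraint n → Fin n → ℚ
d c a i = c i * inv (coef a i)

dmin : ∀ {n} → Vecℚ n → Constraint n → ℚ
dmin c a = minList (map (d c a) (support a))

lhs : ∀ {n} → Constraint n → Vecℚ n → ℚ
lhs a x = Σ[ (λ i → coef a i * x i) ]

cost : ∀ {n} → Vecℚ n → Vecℚ n → ℚ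
cost c x = Σ[ (λ i → c i * x i) ]

ℕtoℚ : ℕ → ℚ
ℕtoℚ k = (+ k) / 1

update : ∀ {n} → ℕ → Vecℚ n → Constraint n → Vecℚ n → Vecℚ n
update k c a x i with 0ℚ <? coef a i
... | no  _ = x i
... | yes _ =
  (1ℚ + dmin c a * inv (d c a i)) * x i
    + inv (ℕtoℚ k * coef a i) * (dmin c a * inv (d c a i))

iter : ∀ {n} → ℕ → Vecℚ n → Constraint n → ℕ → Vecℚ n → Vecℚ n
iter k c a zero    x = x
iter k c a (suc s) x = update k c a (iter k c a s x)

-- The while loop, started at x, performs exactly t updates:
-- the constraint is violated before each of the first t updates and satisfied after t.
Loop : ∀ {n} → ℕ → Vecℚ n → Constraint n → Vecℚ n → ℕ → Set
Loop k c a x t =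
  (∀ s → s ℕ.< t → lhs a (iter k c a s x) < 1ℚ) × (1ℚ ≤ lhs a (iter k c a t x))

-- Run c cs x : processing the constraints cs (in arrival order) from x = 0
-- with Algorithm I yields the primal vector x.
data Run {n : ℕ} (c : Vecℚ n) : List (Constraint n) → Vecℚ n → Set where
  start : Run c [] (λ _ → 0ℚ)
  step  : ∀ {cs x} (a : Constraint n) (t : ℕ) →
          Run c cs x →
          Loop (kOf (cs ++ [ a ])) c a x t →
          Run c (cs ++ [ a ]) (iter (kOf (cs ++ [ a ])) c a t x)

-- One update raises Σ c_i x_i by exactly d_m · Σ_i a_i x_i + |T| · d_m / k: on T the
-- factor d_m / d_i turns c_i into d_m a_i, and the additive term contributes d_m / k
-- per index of T.  While the constraint is violated Σ_i a_i x_i < 1, and |T| ≤ k by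
-- the choice of k, so each of the t updates raises the cost by at most 2 d_m.
module Submission where

open import Defs
open import Data.Nat using (ℕ)
open import Data.Fin using (Fin)
open import Data.List using (List; _++_; [_])
open import Data.Rational using (ℚ; 0ℚ; _<_; _≤_; _-_; _*_)

open import Data.Empty using (⊥-elim)
import Data.Integer as ℤ
import Data.Integer.Properties as ℤ
open import Data.List using ([]; _∷_; map; filter; length; foldr; allFin)
open import Data.List.Relation.Unary.All using (All; []; _∷_)
import Data.List.Relation.Unary.All as All
import Data.List.Relation.Unary.All.Properties as All
import Data.Nat as ℕ
import Data.Nat.Coprimality as Coprimality
open import Data.Nat.Logarithm using (⌈log₂_⌉)
open import Data.Nat.Logarithm.Core using (⌈log2⌉)
import Data.Nat.Properties as ℕ
open import Data.Product using (_,_)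
open import Data.Rational using (1ℚ; _+_; -_; mkℚ; *≤*; ≢-nonZero; positive; nonNegative; NonNegative)
open import Data.Rational.Properties
open import Data.Rational.Solver using (module +-*-Solver)
open import Induction.WellFounded using (Acc; acc)
open import Relation.Binary.PropositionalEquality
  using (_≡_; _≢_; refl; sym; trans; cong; cong₂; module ≡-Reasoning)
open import Relation.Nullary using (yes; no)
open import Relation.Unary using (Pred; Decidable)
open import Level using (0ℓ)

open +-*-Solver

n≤2^⌈log2⌉n : ∀ n (rec : Acc ℕ._<_ n) → n ℕ.≤ 2 ℕ.^ ⌈log2⌉ n rec
n≤2^⌈log2⌉n 0 _ = ℕ.z≤n
n≤2^⌈log2⌉n 1 _ = ℕ.s≤s ℕ.z≤n
n≤2^⌈log2⌉n (ℕ.suc (ℕ.suc n)) (acc rs) = begin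
  2 ℕ.+ n                     ≤⟨ ℕ.+-monoʳ-≤ 2 n≤h+h ⟩
  2 ℕ.+ (h ℕ.+ h)             ≡⟨ sym (ℕ.+-suc (ℕ.suc h) h) ⟩
  ℕ.suc h ℕ.+ ℕ.suc h         ≤⟨ ℕ.+-mono-≤ 1+h≤2^L 1+h≤2^L ⟩
  2 ℕ.^ L ℕ.+ 2 ℕ.^ L         ≡⟨ cong (2 ℕ.^ L ℕ.+_) (sym (ℕ.+-identityʳ (2 ℕ.^ L))) ⟩
  2 ℕ.^ ℕ.suc L ∎
  where
  open ℕ.≤-Reasoning
  h = ℕ.⌈ n /2⌉
  L = ⌈log2⌉ (ℕ.suc h) (rs (ℕ.⌈n/2⌉<n n))
  1+h≤2^L : ℕ.suc h ℕ.≤ 2 ℕ.^ L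
  1+h≤2^L = n≤2^⌈log2⌉n (ℕ.suc h) (rs (ℕ.⌈n/2⌉<n n))
  n≤h+h : n ℕ.≤ h ℕ.+ h
  n≤h+h = begin
    n                   ≡⟨ sym (ℕ.⌊n/2⌋+⌈n/2⌉≡n n) ⟩
    ℕ.⌊ n /2⌋ ℕ.+ h     ≤⟨ ℕ.+-monoˡ-≤ h (ℕ.⌊n/2⌋≤⌈n/2⌉ n) ⟩
    h ℕ.+ h ∎

n≤pow2ceil : ∀ n → n ℕ.≤ pow2ceil n
n≤pow2ceil n = n≤2^⌈log2⌉n n _

f≤foldr-⊔-map-snoc : ∀ {A : Set} (f : A → ℕ) (b : ℕ) (xs : List A) (y : A) →
                     f y ℕ.≤ foldr ℕ._⊔_ b (map f (xs ++ [ y ]))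
f≤foldr-⊔-map-snoc f b []       y = ℕ.m≤m⊔n (f y) b
f≤foldr-⊔-map-snoc f b (x ∷ xs) y = ℕ.≤-trans (f≤foldr-⊔-map-snoc f b xs y) (ℕ.m≤n⊔m (f x) _)

size≤kOf : ∀ {n} (cs : List (Constraint n)) (a : Constraint n) → size a ℕ.≤ kOf (cs ++ [ a ])
size≤kOf cs a = ℕ.≤-trans (f≤foldr-⊔-map-snoc size 2 cs a) (n≤pow2ceil _)

kOf-pos : ∀ {n} (cs : List (Constraint n)) → 0 ℕ.< kOf cs
kOf-pos cs = ℕ.m^n>0 2 (⌈log₂ foldr ℕ._⊔_ 2 (map size cs) ⌉)

coprime-1 : ∀ n → Coprimality.Coprime n 1
coprime-1 n = Coprimality.sym (Coprimality.1-coprimeTo n)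

ℕtoℚ≡mkℚ : ∀ n → ℕtoℚ n ≡ mkℚ (ℤ.+ n) 0 (coprime-1 n)
ℕtoℚ≡mkℚ n = normalize-coprime (coprime-1 n)

ℕtoℚ-suc : ∀ n → ℕtoℚ (ℕ.suc n) ≡ 1ℚ + ℕtoℚ n
ℕtoℚ-suc n = begin
  -- 1ℚ + n/1 unfolds to (1 · 1 + n · 1) / (1 · 1)
  ℕtoℚ (ℕ.suc n)                    ≡⟨ /-cong (cong (ℤ._+_ (ℤ.+ 1)) (sym (ℤ.*-identityʳ (ℤ.+ n)))) refl ⟩
  1ℚ + mkℚ (ℤ.+ n) 0 (coprime-1 n)  ≡⟨ cong (1ℚ +_) (sym (ℕtoℚ≡mkℚ n)) ⟩
  1ℚ + ℕtoℚ n ∎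
  where open ≡-Reasoning

ℕtoℚ-mono-≤ : ∀ {m n} → m ℕ.≤ n → ℕtoℚ m ≤ ℕtoℚ n
ℕtoℚ-mono-≤ {m} {n} m≤n rewrite ℕtoℚ≡mkℚ m | ℕtoℚ≡mkℚ n =
  *≤* (ℤ.*-monoʳ-≤-nonNeg (ℤ.+ 1) (ℤ.+≤+ m≤n))

ℕtoℚ-pos : ∀ {n} → 0 ℕ.< n → 0ℚ < ℕtoℚ n
ℕtoℚ-pos {ℕ.suc n} _ rewrite ℕtoℚ≡mkℚ (ℕ.suc n) = positive⁻¹ _

*-inv : ∀ q → q ≢ 0ℚ → q * inv q ≡ 1ℚ
*-inv q q≢0 with q ≟ 0ℚ
... | yes q≡0 = ⊥-elim (q≢0 q≡0)
... | no  q≢0 = *-inverseʳ q {{≢-nonZero q≢0}}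

inv-pos : ∀ q → 0ℚ < q → 0ℚ < inv q
inv-pos q 0<q with q ≟ 0ℚ
... | yes q≡0 = ⊥-elim (<⇒≢ 0<q (sym q≡0))
... | no  q≢0 = positive⁻¹ _ {{1/pos⇒pos q {{positive 0<q}}}}

pos⇒≢0 : ∀ {q} → 0ℚ < q → q ≢ 0ℚ
pos⇒≢0 0<q q≡0 = <⇒≢ 0<q (sym q≡0)

pos*pos : ∀ {p q} → 0ℚ < p → 0ℚ < q → 0ℚ < p * q
pos*pos {p} {q} 0<p 0<q = positive⁻¹ _ {{pos*pos⇒pos p {{positive 0<p}} q {{positive 0<q}}}}

inv-unique : ∀ p q → p ≢ 0ℚ → p * q ≡ 1ℚ → inv p ≡ q
inv-unique p q p≢0 pq≡1 = begin
  inv p              ≡⟨ sym (*-identityʳ (inv p)) ⟩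
  inv p * 1ℚ         ≡⟨ cong (inv p *_) (sym pq≡1) ⟩
  inv p * (p * q)    ≡⟨ solve 3 (λ i p q → i :* (p :* q) := (p :* i) :* q) refl (inv p) p q ⟩
  (p * inv p) * q    ≡⟨ cong (_* q) (*-inv p p≢0) ⟩
  1ℚ * q             ≡⟨ *-identityˡ q ⟩
  q ∎
  where open ≡-Reasoning

inv-involutive : ∀ q → q ≢ 0ℚ → inv (inv q) ≡ q
inv-involutive q q≢0 = inv-unique (inv q) q inv[q]≢0 (trans (*-comm (inv q) q) (*-inv q q≢0))
  where
  inv[q]≢0 : inv q ≢ 0ℚ
  inv[q]≢0 inv[q]≡0 = 1≢0 (trans (sym (*-inv q q≢0)) (trans (cong (q *_) inv[q]≡0) (*-zeroʳ q)))

inv-distrib-* : ∀ {p q} → 0ℚ < p → 0ℚ < q → inv (p * q) ≡ inv p * inv q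
inv-distrib-* {p} {q} 0<p 0<q = inv-unique (p * q) (inv p * inv q) (pos⇒≢0 (pos*pos 0<p 0<q)) (begin
  (p * q) * (inv p * inv q)    ≡⟨ solve 4 (λ p q i j → (p :* q) :* (i :* j) := (p :* i) :* (q :* j)) refl p q (inv p) (inv q) ⟩
  (p * inv p) * (q * inv q)    ≡⟨ cong₂ _*_ (*-inv p (pos⇒≢0 0<p)) (*-inv q (pos⇒≢0 0<q)) ⟩
  1ℚ * 1ℚ                      ≡⟨ *-identityˡ 1ℚ ⟩
  1ℚ ∎)
  where open ≡-Reasoning

*-inv-*-inv : ∀ {p q} → 0ℚ < p → 0ℚ < q → p * inv (p * inv q) ≡ q
*-inv-*-inv {p} {q} 0<p 0<q = begin
  p * inv (p * inv q)         ≡⟨ cong (p *_) (inv-distrib-* 0<p (inv-pos q 0<q)) ⟩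
  p * (inv p * inv (inv q))   ≡⟨ cong (λ r → p * (inv p * r)) (inv-involutive q (pos⇒≢0 0<q)) ⟩
  p * (inv p * q)             ≡⟨ sym (*-assoc p (inv p) q) ⟩
  (p * inv p) * q             ≡⟨ cong (_* q) (*-inv p (pos⇒≢0 0<p)) ⟩
  1ℚ * q                      ≡⟨ *-identityˡ q ⟩
  q ∎
  where open ≡-Reasoning

inv-*-cancelʳ : ∀ {p q} → 0ℚ < p → 0ℚ < q → inv (p * q) * q ≡ inv p
inv-*-cancelʳ {p} {q} 0<p 0<q = begin
  inv (p * q) * q             ≡⟨ cong (_* q) (inv-distrib-* 0<p 0<q) ⟩
  (inv p * inv q) * q         ≡⟨ *-assoc (inv p) (inv q) q ⟩
  inv p * (inv q * q)         ≡⟨ cong (inv p *_) (trans (*-comm (inv q) q) (*-inv q (pos⇒≢0 0<q))) ⟩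
  inv p * 1ℚ                  ≡⟨ *-identityʳ (inv p) ⟩
  inv p ∎
  where open ≡-Reasoning

indicator : ∀ {A : Set} {P : Pred A 0ℓ} → Decidable P → ℚ → A → ℚ
indicator P? q x with P? x
... | yes _ = q
... | no  _ = 0ℚ

c*update : ∀ {n} (c : Vecℚ n) → (∀ i → 0ℚ < c i) → (k : ℕ) → 0 ℕ.< k →
           (a : Constraint n) (x : Vecℚ n) (i : Fin n) →
           c i * update k c a x i
             ≡ c i * x i + (dmin c a * (coef a i * x i)
                            + indicator (λ j → 0ℚ <? coef a j) (dmin c a * inv (ℕtoℚ k)) i)
c*update c 0<c k 0<k a x i with 0ℚ <? coef a i
... | no 0≮α = begin
  c i * x i                                ≡⟨ sym (+-identityʳ (c i * x i)) ⟩
  c i * x i + 0ℚ                           ≡⟨ cong (c i * x i +_) (solve 2 (λ m y → con 0ℚ := m :* (con 0ℚ :* y) :+ con 0ℚ) refl (dmin c a) (x i)) ⟩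
  c i * x i + (dmin c a * (0ℚ * x i) + 0ℚ)  ≡⟨ cong (λ α → c i * x i + (dmin c a * (α * x i) + 0ℚ)) (sym α≡0) ⟩
  c i * x i + (dmin c a * (coef a i * x i) + 0ℚ) ∎
  where
  open ≡-Reasoning
  α≡0 : coef a i ≡ 0ℚ
  α≡0 = ≤-antisym (≮⇒≥ 0≮α) (nonneg a i)
... | yes 0<α = begin
  γ * ((1ℚ + m * e) * y + j * (m * e))
    ≡⟨ solve 5 (λ γ m e y j → γ :* ((con 1ℚ :+ m :* e) :* y :+ j :* (m :* e))
                 := γ :* y :+ (m :* ((γ :* e) :* y) :+ m :* (j :* (γ :* e)))) refl γ m e y j ⟩
  γ * y + (m * ((γ * e) * y) + m * (j * (γ * e)))
    ≡⟨ cong (λ r → γ * y + (m * (r * y) + m * (j * r))) (*-inv-*-inv (0<c i) 0<α) ⟩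
  γ * y + (m * (α * y) + m * (j * α))
    ≡⟨ cong (λ r → γ * y + (m * (α * y) + m * r)) (inv-*-cancelʳ (ℕtoℚ-pos 0<k) 0<α) ⟩
  γ * y + (m * (α * y) + m * inv (ℕtoℚ k)) ∎
  where
  open ≡-Reasoning
  γ = c i
  α = coef a i
  y = x i
  m = dmin c a
  e = inv (d c a i)
  j = inv (ℕtoℚ k * α)

module _ {A : Set} where

  sumℚ-map-cong : ∀ (l : List A) {f g : A → ℚ} → (∀ x → f x ≡ g x) →
                  sumℚ (map f l) ≡ sumℚ (map g l)
  sumℚ-map-cong []      f≗g = refl
  sumℚ-map-cong (x ∷ l) f≗g = cong₂ _+_ (f≗g x) (sumℚ-map-cong l f≗g)

  sumℚ-map-+ : ∀ (l : List A) (f g : A → ℚ) →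
               sumℚ (map (λ x → f x + g x) l) ≡ sumℚ (map f l) + sumℚ (map g l)
  sumℚ-map-+ []      f g = refl
  sumℚ-map-+ (x ∷ l) f g rewrite sumℚ-map-+ l f g =
    solve 4 (λ a b c e → (a :+ b) :+ (c :+ e) := (a :+ c) :+ (b :+ e)) refl
      (f x) (g x) (sumℚ (map f l)) (sumℚ (map g l))

  sumℚ-map-*ˡ : ∀ (l : List A) (q : ℚ) (f : A → ℚ) →
                sumℚ (map (λ x → q * f x) l) ≡ q * sumℚ (map f l)
  sumℚ-map-*ˡ []      q f = sym (*-zeroʳ q)
  sumℚ-map-*ˡ (x ∷ l) q f rewrite sumℚ-map-*ˡ l q f = sym (*-distribˡ-+ q (f x) _)

  sumℚ-map-indicator : ∀ {P : Pred A 0ℓ} (P? : Decidable P) (q : ℚ) (l : List A) →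
                       sumℚ (map (indicator P? q) l) ≡ ℕtoℚ (length (filter P? l)) * q
  sumℚ-map-indicator P? q []      = sym (*-zeroˡ q)
  sumℚ-map-indicator P? q (x ∷ l) with P? x
  ... | no  _ = trans (+-identityˡ _) (sumℚ-map-indicator P? q l)
  ... | yes _ = begin
    q + sumℚ (map (indicator P? q) l)   ≡⟨ cong (q +_) (sumℚ-map-indicator P? q l) ⟩
    q + ℕtoℚ L * q                     ≡⟨ solve 2 (λ q n → q :+ n :* q := (con 1ℚ :+ n) :* q) refl q (ℕtoℚ L) ⟩
    (1ℚ + ℕtoℚ L) * q                   ≡⟨ cong (_* q) (sym (ℕtoℚ-suc L)) ⟩
    ℕtoℚ (ℕ.suc L) * q ∎
    where
    open ≡-Reasoning
    L = length (filter P? l)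

cost-update : ∀ {n} (c : Vecℚ n) → (∀ i → 0ℚ < c i) → (k : ℕ) → 0 ℕ.< k →
              (a : Constraint n) (x : Vecℚ n) →
              cost c (update k c a x)
                ≡ cost c x + (dmin c a * lhs a x + ℕtoℚ (size a) * (dmin c a * inv (ℕtoℚ k)))
cost-update {n} c 0<c k 0<k a x = begin
  cost c (update k c a x)
    ≡⟨ sumℚ-map-cong I (c*update c 0<c k 0<k a x) ⟩
  sumℚ (map (λ i → c i * x i + (m * (coef a i * x i) + χ i)) I)
    ≡⟨ sumℚ-map-+ I (λ i → c i * x i) _ ⟩
  cost c x + sumℚ (map (λ i → m * (coef a i * x i) + χ i) I)
    ≡⟨ cong (cost c x +_) (sumℚ-map-+ I (λ i → m * (coef a i * x i)) χ) ⟩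
  cost c x + (sumℚ (map (λ i → m * (coef a i * x i)) I) + sumℚ (map χ I))
    ≡⟨ cong₂ (λ u v → cost c x + (u + v)) (sumℚ-map-*ˡ I m (λ i → coef a i * x i))
                                          (sumℚ-map-indicator (λ i → 0ℚ <? coef a i) _ I) ⟩
  cost c x + (m * lhs a x + ℕtoℚ (size a) * (m * inv (ℕtoℚ k))) ∎
  where
  open ≡-Reasoning
  I = allFin n
  m = dmin c a
  χ = indicator (λ i → 0ℚ <? coef a i) (m * inv (ℕtoℚ k))

minList-nonNeg : (l : List ℚ) → All (0ℚ ≤_) l → 0ℚ ≤ minList l
minList-nonNeg []           _              = ≤-refl
minList-nonNeg (x ∷ [])     (0≤x ∷ [])     = 0≤x
minList-nonNeg (x ∷ y ∷ ys) (0≤x ∷ 0≤y∷ys) = ⊓-glb 0≤x (minList-nonNeg (y ∷ ys) 0≤y∷ys)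

dmin-nonNeg : ∀ {n} (c : Vecℚ n) → (∀ i → 0ℚ < c i) → (a : Constraint n) → 0ℚ ≤ dmin c a
dmin-nonNeg {n} c 0<c a = minList-nonNeg _ (All.map⁺ (All.map 0≤d (All.all-filter P? (allFin n))))
  where
  P? = λ i → 0ℚ <? coef a i
  0≤d : ∀ {i} → 0ℚ < coef a i → 0ℚ ≤ d c a i
  0≤d {i} 0<α = <⇒≤ (pos*pos (0<c i) (inv-pos (coef a i) 0<α))

cost-update-≤ : ∀ {n} (c : Vecℚ n) → (∀ i → 0ℚ < c i) → (k : ℕ) → 0 ℕ.< k →
                (a : Constraint n) → size a ℕ.≤ k → (x : Vecℚ n) → lhs a x < 1ℚ →
                cost c (update k c a x) ≤ cost c x + (dmin c a + dmin c a)
cost-update-≤ c 0<c k 0<k a |T|≤k x violated = begin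
  cost c (update k c a x)
    ≡⟨ cost-update c 0<c k 0<k a x ⟩
  cost c x + (m * lhs a x + ℕtoℚ (size a) * (m * inv K))
    ≡⟨ cong (λ r → cost c x + (m * lhs a x + r)) (solve 3 (λ s m i → s :* (m :* i) := m :* (i :* s)) refl (ℕtoℚ (size a)) m (inv K)) ⟩
  cost c x + (m * lhs a x + m * (inv K * ℕtoℚ (size a)))
    ≤⟨ +-monoʳ-≤ (cost c x) (+-mono-≤ (*-monoˡ-≤-nonNeg m (<⇒≤ violated)) (*-monoˡ-≤-nonNeg m |T|/k≤1)) ⟩
  cost c x + (m * 1ℚ + m * 1ℚ)
    ≡⟨ cong (λ r → cost c x + (r + r)) (*-identityʳ m) ⟩
  cost c x + (m + m) ∎
  where
  open ≤-Reasoning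
  m = dmin c a
  K = ℕtoℚ k
  0<K = ℕtoℚ-pos 0<k
  instance
    m-nonNeg : NonNegative m
    m-nonNeg = nonNegative (dmin-nonNeg c 0<c a)
    inv[K]-nonNeg : NonNegative (inv K)
    inv[K]-nonNeg = nonNegative (<⇒≤ (inv-pos K 0<K))
  |T|/k≤1 : inv K * ℕtoℚ (size a) ≤ 1ℚ
  |T|/k≤1 = begin
    inv K * ℕtoℚ (size a)   ≤⟨ *-monoˡ-≤-nonNeg (inv K) (ℕtoℚ-mono-≤ |T|≤k) ⟩
    inv K * K               ≡⟨ trans (*-comm (inv K) K) (*-inv K (pos⇒≢0 0<K)) ⟩
    1ℚ ∎

≤-telescope : (f : ℕ → ℚ) (δ : ℚ) (t : ℕ) → (∀ s → s ℕ.< t → f (ℕ.suc s) ≤ f s + δ) →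
              f t - f 0 ≤ ℕtoℚ t * δ
≤-telescope f δ ℕ.zero    _         = ≤-reflexive (trans (+-inverseʳ (f 0)) (sym (*-zeroˡ δ)))
≤-telescope f δ (ℕ.suc t) increment = begin
  f (ℕ.suc t) - f 0       ≤⟨ +-monoˡ-≤ (- f 0) (increment t ℕ.≤-refl) ⟩
  (f t + δ) - f 0         ≡⟨ solve 3 (λ a δ b → (a :+ δ) :- b := (a :- b) :+ δ) refl (f t) δ (f 0) ⟩
  (f t - f 0) + δ         ≤⟨ +-monoˡ-≤ δ (≤-telescope f δ t (λ s s<t → increment s (ℕ.m<n⇒m<1+n s<t))) ⟩
  ℕtoℚ t * δ + δ          ≡⟨ solve 2 (λ n δ → n :* δ :+ δ := (con 1ℚ :+ n) :* δ) refl (ℕtoℚ t) δ ⟩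
  (1ℚ + ℕtoℚ t) * δ       ≡⟨ cong (_* δ) (sym (ℕtoℚ-suc t)) ⟩
  ℕtoℚ (ℕ.suc t) * δ ∎
  where open ≤-Reasoning

-- The bound holds from any starting vector.
lemma2 : ∀ {n} (c : Vecℚ n) → (∀ i → 0ℚ < c i) →
         (cs : List (Constraint n)) (a : Constraint n) (x : Vecℚ n) →
         Run c cs x →
         (t : ℕ) → Loop (kOf (cs ++ [ a ])) c a x t →
         cost c (iter (kOf (cs ++ [ a ])) c a t x) - cost c x
           ≤ ℕtoℚ 2 * ℕtoℚ t * dmin c a
lemma2 c 0<c cs a x _ t (violated , _) = begin
  cost c (iter k c a t x) - cost c x   ≤⟨ ≤-telescope (λ s → cost c (iter k c a s x)) (m + m) t per-update ⟩
  ℕtoℚ t * (m + m)                     ≡⟨ solve 2 (λ t m → t :* (m :+ m) := (con 1ℚ :+ con 1ℚ) :* t :* m) refl (ℕtoℚ t) m ⟩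
  ℕtoℚ 2 * ℕtoℚ t * m ∎
  where
  open ≤-Reasoning
  k = kOf (cs ++ [ a ])
  m = dmin c a
  per-update : ∀ s → s ℕ.< t → cost c (iter k c a (ℕ.suc s) x) ≤ cost c (iter k c a s x) + (m + m)
  per-update s s<t = cost-update-≤ c 0<c k (kOf-pos (cs ++ [ a ])) a (size≤kOf cs a) _ (violated s s<t)
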